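{- Let $H$ be a linear hypergraph, $\mathscr{H}$ a set of subhypergraphs of $H$ with $\mathrm{Girth}(H,\mathscr{H}^+)>(2,2)$, and $\mathscr{C}$ a tidy cycle of copies in $\mathscr{H}^+$. (a) If $\mathscr{C}$ has length $2$, then every real copy of $\mathscr{C}$ is a master copy of $\mathscr{C}$. (b) If $\mathscr{C}$ has length at least $3$, then $\mathscr{C}$ has at most one master copy.
   Context: Hypergraphs are pairs $(V,E)$ with $E$ a set of $k$-subsets of a finite set $V$; linear means two distinct edges share at most one vertex. For $e\in E(H)$, $e^+=(e,\{e\})$ is an edge copy, $\mathscr{H}^+=\mathscr{H}\cup\{e^+:e\in E(H)\}$, and members of $\mathscr{H}^+$ that are not edge copies are real copies. A cycle of copies is a cyclic sequence $F_1q_1\ldots F_nq_n$, $n\ge2$ (its length), with $F_i\in\mathscr{H}^+$, $F_i\ne F_{i+1}$, connectors $q_i$ distinct elements of $V(H)\cup E(H)$, a vertex $q_i$ in $V(F_i)\cap V(F_{i+1})$, an edge $q_i$ in $E(F_i)\cap E(F_{i+1})$. Index $i$ pure if $q_{i-1},q_i$ are both vertices or both edges, mixed otherwise; order $=$ #pure$+\frac12$#mixed; $h(\mathscr{C})=(\text{order},\text{length})$ ordered lexicographically. Tidy: (T1) no connectors $q_i,q_j$ with $q_i\in q_j$; (T2) for every edge $f$, $\{i:q_i$ vertex in $f\}\subseteq\{i_\star,i_\star+1\}$ for some $i_\star$. A master copy of the cycle is a copy $F_\star$ occurring in it together with edges $f_i\in E(F_\star)$ for each $i$ with $F_i\ne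 F_\star$ such that replacing these $F_i$ by $f_i^+$ yields a cycle of copies. $\mathrm{Girth}(H,\mathscr{H}^+)>(2,2)$ means every tidy cycle of copies $\mathscr{C}$ with $h(\mathscr{C})\le(2,2)$ has a master copy. -}

module Defs where

open import Level using (0ℓ)
open import Data.Nat using (ℕ; zero; suc; _+_; _*_; _≤_; _<_)
open import Data.Fin using (Fin; zero; suc)
open import Data.Fin.Subset using (Subset; _∈_; _⊆_; _∩_; ∣_∣; ⁅_⁆)
open import Data.Bool using (Bool)
import Data.Bool.Properties as BoolP
import Data.Vec.Properties as VecP
import Data.Product.Properties as ProdP
open import Data.Maybe using (Maybe; just; nothing; maybe′)
import Data.Maybe as Maybe
open import Data.Product using (Σ; ∃; ∃-syntax; _×_; _,_; proj₁; proj₂)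
open import Data.Sum using (_⊎_; inj₁; inj₂)
open import Data.List using (List; allFin)
open import Data.Nat.ListAction using (sum)
import Data.List as List
open import Function using (id)
open import Relation.Nullary using (¬_; Dec; yes; no)
open import Relation.Unary using (Pred)
open import Relation.Binary.PropositionalEquality using (_≡_; _≢_; refl)
open import Relation.Binary using (DecidableEquality)

bump : ∀ {n} → Fin n → Maybe (Fin n)
bump {suc zero}    zero    = nothing
bump {suc (suc n)} zero    = just (suc zero)
bump {suc (suc n)} (suc i) = Maybe.map suc (bump i)

-- next i = i + 1 (mod n)
next : ∀ {n} → Fin n → Fin n
next {suc n} i = maybe′ id zero (bump i)

-- A k-uniform hypergraph H = (V, E) with V = Fin nV and the edge set E
-- given by an injective enumeration  edge : Fin nE → Subset nV  of
-- k-subsets of V.  (Edges of H are referred to by their index in Fin nE.)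

record Hypergraph : Set where
  field
    nV   : ℕ
    nE   : ℕ
    k    : ℕ
    edge : Fin nE → Subset nV
    edge-injective : ∀ e f → edge e ≡ edge f → e ≡ f
    edge-size      : ∀ e → ∣ edge e ∣ ≡ k
open Hypergraph public

Linear : Hypergraph → Set
Linear H = ∀ e f → e ≢ f → ∣ edge H e ∩ edge H f ∣ ≤ 1

record SubHG (H : Hypergraph) : Set where
  constructor ⟨_,_⟩
  field
    V[_] : Subset (nV H)
    E[_] : Subset (nE H)
open SubHG public

IsSubHG : (H : Hypergraph) → SubHG H → Set
IsSubHG H F = ∀ e → e ∈ E[ F ] → edge H e ⊆ V[ F ]

_≟S_ : ∀ {H} → DecidableEquality (SubHG H)
⟨ V₁ , E₁ ⟩ ≟S ⟨ V₂ , E₂ ⟩ with VecP.≡-dec BoolP._≟_ V₁ V₂ | VecP.≡-dec BoolP._≟_ E₁ E₂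
... | yes refl | yes refl = yes refl
... | no ne    | _        = no (λ { refl → ne refl })
... | yes _    | no ne    = no (λ { refl → ne refl })

_⁺ : ∀ {H} → Fin (nE H) → SubHG H
_⁺ {H} e = ⟨ edge H e , ⁅ e ⁆ ⟩

IsEdgeCopy : ∀ {H} → SubHG H → Set
IsEdgeCopy {H} F = ∃[ e ] F ≡ _⁺ {H} e

_⁺∋_ : ∀ {H} → Pred (SubHG H) 0ℓ → SubHG H → Set
ℋ ⁺∋ F = ℋ F ⊎ IsEdgeCopy F

Conn : Hypergraph → Set
Conn H = Fin (nV H) ⊎ Fin (nE H)

Joins : ∀ {H} → Conn H → SubHG H → SubHG H → Set
Joins (inj₁ v) F F' = v ∈ V[ F ] × v ∈ V[ F' ]
Joins (inj₂ e) F F' = e ∈ E[ F ] × e ∈ E[ F' ]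

IsCycle : ∀ {H} → Pred (SubHG H) 0ℓ → (n : ℕ) →
          (Fin n → SubHG H) → (Fin n → Conn H) → Set
IsCycle {H} ℋ n F q =
  (2 ≤ n) ×
  (∀ i → ℋ ⁺∋ F i) ×
  (∀ i → F i ≢ F (next i)) ×
  (∀ i j → q i ≡ q j → i ≡ j) ×
  (∀ i → Joins {H} (q i) (F i) (F (next i)))

-- Order.  Index (next i) is pure iff q i and q (next i) are of the same
-- kind (both vertices or both edges), mixed otherwise.  We use twice the
-- order: 2·order = 2·#pure + #mixed, to stay in ℕ.

weight : ∀ {H} → Conn H → Conn H → ℕ
weight (inj₁ _) (inj₁ _) = 2
weight (inj₂ _) (inj₂ _) = 2
weight (inj₁ _) (inj₂ _) = 1
weight (inj₂ _) (inj₁ _) = 1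

twiceOrder : ∀ {H} {n} → (Fin n → Conn H) → ℕ
twiceOrder {H} {n} q = sum (List.map (λ i → weight {H} (q i) (q (next i))) (allFin n))

-- h(𝒞) = (order, length) ≤ (2,2) lexicographically
h≤22 : ∀ {H} (n : ℕ) → (Fin n → Conn H) → Set
h≤22 {H} n q = (twiceOrder {H} q < 4) ⊎ (twiceOrder {H} q ≡ 4 × n ≤ 2)

T1 : ∀ {H} {n} → (Fin n → Conn H) → Set
T1 {H} q = ∀ i j v e → q i ≡ inj₁ v → q j ≡ inj₂ e → ¬ (v ∈ edge H e)

T2 : ∀ {H} {n} → (Fin n → Conn H) → Set
T2 {H} {n} q = ∀ f → ∃[ i⋆ ] ∀ (i : Fin n) v →
  q i ≡ inj₁ v → v ∈ edge H f → (i ≡ i⋆ ⊎ i ≡ next i⋆)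

IsTidyCycle : ∀ {H} → Pred (SubHG H) 0ℓ → (n : ℕ) →
              (Fin n → SubHG H) → (Fin n → Conn H) → Set
IsTidyCycle {H} ℋ n F q = IsCycle {H} ℋ n F q × T1 {H} q × T2 {H} q

replaceBy : ∀ {H} {n} (F : Fin n → SubHG H) (F⋆ : SubHG H) →
            ((i : Fin n) → F i ≢ F⋆ → Fin (nE H)) → Fin n → SubHG H
replaceBy {H} F F⋆ f i with F i ≟S F⋆
... | yes _ = F⋆
... | no ne = _⁺ {H} (f i ne)

IsMasterCopy : ∀ {H} → Pred (SubHG H) 0ℓ → (n : ℕ) →
               (Fin n → SubHG H) → (Fin n → Conn H) → SubHG H → Set
IsMasterCopy {H} ℋ n F q F⋆ =
  (∃[ j ] F j ≡ F⋆) ×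
  (∃[ f ] ((∀ i (ne : F i ≢ F⋆) → f i ne ∈ E[ F⋆ ]) ×
           IsCycle {H} ℋ n (replaceBy {H} F F⋆ f) q))

Girth>22 : (H : Hypergraph) → Pred (SubHG H) 0ℓ → Set
Girth>22 H ℋ = ∀ n (F : Fin n → SubHG H) (q : Fin n → Conn H) →
  IsTidyCycle {H} ℋ n F q → h≤22 {H} n q →
  ∃[ F⋆ ] IsMasterCopy {H} ℋ n F q F⋆

{-# OPTIONS --safe #-}
-- Every cycle of length 2 has order at most 2, so Girth(H, ℋ⁺) > (2,2) gives it a master
-- copy P; replacing the other copy by an edge copy of P shows that some edge of P contains
-- both connectors.
-- (a) Such an edge g₀ exists for the given cycle. The cycle formed by the real copy F j and
-- g₀⁺ with the same connectors must have F j as its master, so some edge of F j contains both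
-- connectors, and replacing the other copy by it exhibits F j as a master copy.
-- (b) Two distinct master copies A, B contain every connector, so any two connectors form a
-- length-2 cycle with A and B, and by (T1) they are vertices of a common edge. For length at
-- least 4, q₀ and q₂ then contradict (T2). For length 3, some copy is neither A nor B; both
-- masters replace it by an edge through the two vertex connectors around it, so by linearity
-- A and B share this edge. It then contains all three connectors, again contradicting (T2).
module Submission where

open import Defs
open import Level using (0ℓ)
open import Data.Nat using (ℕ; zero; suc; _+_; _≤_; s≤s; z≤n)
open import Data.Nat.Properties using (≤-trans; <-irrefl)
open import Data.Fin using (Fin; zero; suc; _≟_)
open import Data.Fin.Subset using (Subset; _∈_; ∣_∣; ⁅_⁆)
open import Data.Fin.Subset.Properties
  using (x∈⁅y⁆⇒x≡y; x≢y⇒x∉⁅y⁆; ∣⁅x⁆∣≡1; p⊂q⇒∣p∣<∣q∣; x∈p∩q⁺; _∈?_)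
open import Data.Vec.Functional using ([]; _∷_)
open import Data.Product using (∃-syntax; _×_; _,_; proj₁; proj₂)
open import Data.Sum using (_⊎_; inj₁; inj₂)
open import Data.Sum.Properties using (inj₁-injective)
open import Data.Empty using (⊥; ⊥-elim)
open import Function using (_∘_)
open import Relation.Nullary using (¬_; yes; no)
open import Relation.Nullary.Decidable using (decidable-stable)
open import Relation.Unary using (Pred)
open import Relation.Binary using (DecidableEquality)
open import Relation.Binary.PropositionalEquality
  using (_≡_; _≢_; refl; sym; trans; cong; subst)

∈∧∈⇒2≤∣p∣ : ∀ {n} {x y : Fin n} {p : Subset n} → x ≢ y → x ∈ p → y ∈ p → 2 ≤ ∣ p ∣
∈∧∈⇒2≤∣p∣ {x = x} {p = p} x≢y x∈p y∈p =
  subst (_≤ ∣ p ∣) (cong suc (∣⁅x⁆∣≡1 x))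
    (p⊂q⇒∣p∣<∣q∣ (⁅x⁆⊆p , _ , y∈p , x≢y⇒x∉⁅y⁆ (x≢y ∘ sym)))
  where
    ⁅x⁆⊆p : ∀ {z} → z ∈ ⁅ x ⁆ → z ∈ p
    ⁅x⁆⊆p z∈⁅x⁆ = subst (_∈ p) (sym (x∈⁅y⁆⇒x≡y x z∈⁅x⁆)) x∈p

¬three-distinct-in-pair : ∀ {A : Set} {x y a b c : A} → a ≢ b → b ≢ c → c ≢ a →
  (a ≡ x ⊎ a ≡ y) → (b ≡ x ⊎ b ≡ y) → (c ≡ x ⊎ c ≡ y) → ⊥
¬three-distinct-in-pair a≢b _   _   (inj₁ refl) (inj₁ refl) _           = a≢b refl
¬three-distinct-in-pair a≢b _   _   (inj₂ refl) (inj₂ refl) _           = a≢b refl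
¬three-distinct-in-pair _   _   c≢a (inj₁ refl) (inj₂ refl) (inj₁ refl) = c≢a refl
¬three-distinct-in-pair _   b≢c _   (inj₁ refl) (inj₂ refl) (inj₂ refl) = b≢c refl
¬three-distinct-in-pair _   _   c≢a (inj₂ refl) (inj₁ refl) (inj₂ refl) = c≢a refl
¬three-distinct-in-pair _   b≢c _   (inj₂ refl) (inj₁ refl) (inj₁ refl) = b≢c refl

≡∨≡⊎≢×≢ : ∀ {A : Set} → DecidableEquality A → ∀ (x y z : A) → (z ≡ x ⊎ z ≡ y) ⊎ (z ≢ x × z ≢ y)
≡∨≡⊎≢×≢ _≟A_ x y z with z ≟A x | z ≟A y
... | yes z≡x | _       = inj₁ (inj₁ z≡x)
... | no _    | yes z≡y = inj₁ (inj₂ z≡y)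
... | no z≢x  | no z≢y  = inj₂ (z≢x , z≢y)

∃-avoiding-pair₃ : ∀ {A : Set} → DecidableEquality A → (F : Fin 3 → A) →
  (∀ i → F i ≢ F (next i)) → ∀ x y → ∃[ i ] (F i ≢ x × F i ≢ y)
∃-avoiding-pair₃ _≟A_ F F≢F∘next x y
  with ≡∨≡⊎≢×≢ _≟A_ x y (F zero) | ≡∨≡⊎≢×≢ _≟A_ x y (F (suc zero))
     | ≡∨≡⊎≢×≢ _≟A_ x y (F (suc (suc zero)))
... | inj₂ avoids | _           | _           = zero , avoids
... | inj₁ _      | inj₂ avoids | _           = suc zero , avoids
... | inj₁ _      | inj₁ _      | inj₂ avoids = suc (suc zero) , avoids
... | inj₁ p₀     | inj₁ p₁     | inj₁ p₂     = ⊥-elim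
  (¬three-distinct-in-pair (F≢F∘next zero) (F≢F∘next (suc zero)) (F≢F∘next (suc (suc zero)))
    p₀ p₁ p₂)

≡∨≡next₂ : ∀ (i j : Fin 2) → j ≡ i ⊎ j ≡ next i
≡∨≡next₂ zero       zero       = inj₁ refl
≡∨≡next₂ zero       (suc zero) = inj₂ refl
≡∨≡next₂ (suc zero) zero       = inj₂ refl
≡∨≡next₂ (suc zero) (suc zero) = inj₁ refl

next³≡id : ∀ (i : Fin 3) → next (next (next i)) ≡ i
next³≡id zero             = refl
next³≡id (suc zero)       = refl
next³≡id (suc (suc zero)) = refl

≢next₃ : ∀ (i : Fin 3) → i ≢ next i
≢next₃ zero             ()
≢next₃ (suc zero)       ()
≢next₃ (suc (suc zero)) ()

≢next²₃ : ∀ (i : Fin 3) → i ≢ next (next i)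
≢next²₃ i i≡next²i = ≢next₃ (next (next i)) (trans (sym i≡next²i) (sym (next³≡id i)))

¬zero-two-in-step : ∀ {m} (s : Fin (4 + m)) →
  (zero ≡ s ⊎ zero ≡ next s) → (suc (suc zero) ≡ s ⊎ suc (suc zero) ≡ next s) → ⊥
¬zero-two-in-step s                 (inj₁ refl)      (inj₁ ())
¬zero-two-in-step s                 (inj₁ refl)      (inj₂ ())
¬zero-two-in-step .(suc (suc zero)) (inj₂ ())        (inj₁ refl)
¬zero-two-in-step s                 (inj₂ 0≡next-s) (inj₂ 2≡next-s) with trans 0≡next-s (sym 2≡next-s)
... | ()

module _ {H : Hypergraph} where

  infix 4 _∈ᶜ_
  _∈ᶜ_ : Conn H → SubHG H → Set
  inj₁ v ∈ᶜ X = v ∈ V[ X ]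
  inj₂ e ∈ᶜ X = e ∈ E[ X ]

  Joins⇒∈ᶜˡ : ∀ c {X Y} → Joins {H} c X Y → c ∈ᶜ X
  Joins⇒∈ᶜˡ (inj₁ _) = proj₁
  Joins⇒∈ᶜˡ (inj₂ _) = proj₁

  Joins⇒∈ᶜʳ : ∀ c {X Y} → Joins {H} c X Y → c ∈ᶜ Y
  Joins⇒∈ᶜʳ (inj₁ _) = proj₂
  Joins⇒∈ᶜʳ (inj₂ _) = proj₂

  ∈ᶜ⇒Joins : ∀ c {X Y} → c ∈ᶜ X → c ∈ᶜ Y → Joins {H} c X Y
  ∈ᶜ⇒Joins (inj₁ _) = _,_
  ∈ᶜ⇒Joins (inj₂ _) = _,_

  ∈ᶜ⁺⇒∈ᶜ : ∀ {X g} → IsSubHG H X → g ∈ E[ X ] → ∀ c → c ∈ᶜ g ⁺ → c ∈ᶜ X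
  ∈ᶜ⁺⇒∈ᶜ X-sub g∈X (inj₁ v) v∈g = X-sub _ g∈X v∈g
  ∈ᶜ⁺⇒∈ᶜ {X} X-sub g∈X (inj₂ e) e∈⁅g⁆ = subst (_∈ E[ X ]) (sym (x∈⁅y⁆⇒x≡y _ e∈⁅g⁆)) g∈X

  replaceBy-cases : ∀ {n} (F : Fin n → SubHG H) F⋆ f i →
    (F i ≡ F⋆ × replaceBy F F⋆ f i ≡ F⋆) ⊎ ∃[ ne ] (replaceBy F F⋆ f i ≡ f i ne ⁺)
  replaceBy-cases F F⋆ f i with F i ≟S F⋆
  ... | yes Fi≡F⋆ = inj₁ (Fi≡F⋆ , refl)
  ... | no Fi≢F⋆  = inj₂ (Fi≢F⋆ , refl)

  -- A length-2 cycle has order at most 2: its two indices are both pure or both mixed.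
  h≤22-length2 : (q : Fin 2 → Conn H) → h≤22 {H} 2 q
  h≤22-length2 q with q zero | q (suc zero)
  ... | inj₁ _ | inj₁ _ = inj₂ (refl , s≤s (s≤s z≤n))
  ... | inj₁ _ | inj₂ _ = inj₁ (s≤s (s≤s (s≤s z≤n)))
  ... | inj₂ _ | inj₁ _ = inj₁ (s≤s (s≤s (s≤s z≤n)))
  ... | inj₂ _ | inj₂ _ = inj₂ (refl , s≤s (s≤s z≤n))

  cycle₂-connector∈ᶜ : ∀ {ℋ P Q} → IsCycle {H} ℋ 2 P Q → ∀ a b → Q a ∈ᶜ P b
  cycle₂-connector∈ᶜ {Q = Q} (_ , _ , _ , _ , joins) a b with ≡∨≡next₂ a b
  ... | inj₁ refl = Joins⇒∈ᶜˡ (Q a) (joins a)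
  ... | inj₂ refl = Joins⇒∈ᶜʳ (Q a) (joins a)

  connectors-in-edge⇒vertices : ∀ {n} {q : Fin n → Conn H} →
    (∀ i j → q i ≡ q j → i ≡ j) → T1 {H} q → ∀ {a b} → a ≢ b → ∀ {g} →
    q a ∈ᶜ g ⁺ → q b ∈ᶜ g ⁺ →
    ∃[ u ] ∃[ v ] (q a ≡ inj₁ u × q b ≡ inj₁ v × u ∈ edge H g × v ∈ edge H g)
  connectors-in-edge⇒vertices {q = q} q-inj t1 {a} {b} a≢b {g} qa∈ qb∈
    with q a in qa≡ | q b in qb≡
  ... | inj₁ u | inj₁ v = u , v , refl , refl , qa∈ , qb∈
  ... | inj₂ e | inj₂ f = ⊥-elim (a≢b (q-inj a b (trans qa≡ (trans (cong inj₂ e≡f) (sym qb≡)))))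
    where
      e≡f : e ≡ f
      e≡f = trans (x∈⁅y⁆⇒x≡y g qa∈) (sym (x∈⁅y⁆⇒x≡y g qb∈))
  ... | inj₂ e | inj₁ v =
    ⊥-elim (t1 b a v e qb≡ qa≡ (subst (λ f → v ∈ edge H f) (sym (x∈⁅y⁆⇒x≡y g qa∈)) qb∈))
  ... | inj₁ u | inj₂ e =
    ⊥-elim (t1 a b u e qa≡ qb≡ (subst (λ f → u ∈ edge H f) (sym (x∈⁅y⁆⇒x≡y g qb∈)) qa∈))

  Linear⇒edge-unique : Linear H → ∀ {u v e e′} → u ≢ v →
    u ∈ edge H e → v ∈ edge H e → u ∈ edge H e′ → v ∈ edge H e′ → e ≡ e′
  Linear⇒edge-unique lin {e = e} {e′} u≢v u∈e v∈e u∈e′ v∈e′ =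
    decidable-stable (e ≟ e′) λ e≢e′ →
      <-irrefl refl (≤-trans (∈∧∈⇒2≤∣p∣ u≢v (x∈p∩q⁺ (u∈e , u∈e′)) (x∈p∩q⁺ (v∈e , v∈e′))) (lin e e′ e≢e′))

  connectorPair-determinesEdge : Linear H → ∀ {n} {q : Fin n → Conn H} →
    (∀ i j → q i ≡ q j → i ≡ j) → T1 {H} q → ∀ {a b} → a ≢ b → ∀ {e e′} →
    q a ∈ᶜ e ⁺ → q b ∈ᶜ e ⁺ → q a ∈ᶜ e′ ⁺ → q b ∈ᶜ e′ ⁺ → e ≡ e′
  connectorPair-determinesEdge lin {q = q} q-inj t1 {a} {b} a≢b qa∈e qb∈e qa∈e′ qb∈e′
    with connectors-in-edge⇒vertices q-inj t1 a≢b qa∈e qb∈e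
       | connectors-in-edge⇒vertices q-inj t1 a≢b qa∈e′ qb∈e′
  ... | u , v , qa≡u , qb≡v , u∈e , v∈e | u′ , v′ , qa≡u′ , qb≡v′ , u′∈e′ , v′∈e′ =
    Linear⇒edge-unique lin u≢v u∈e v∈e
      (subst (_∈ edge H _) (sym u≡u′) u′∈e′) (subst (_∈ edge H _) (sym v≡v′) v′∈e′)
    where
      u≡u′ : u ≡ u′
      u≡u′ = inj₁-injective (trans (sym qa≡u) qa≡u′)
      v≡v′ : v ≡ v′
      v≡v′ = inj₁-injective (trans (sym qb≡v) qb≡v′)
      u≢v : u ≢ v
      u≢v u≡v = a≢b (q-inj a b (trans qa≡u (trans (cong inj₁ u≡v) (sym qb≡v))))

module _ {H : Hypergraph} {ℋ : Pred (SubHG H) 0ℓ} where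

  master⇒⁺∋ : ∀ {n F q Z} → IsMasterCopy {H} ℋ n F q Z → ℋ ⁺∋ Z
  master⇒⁺∋ {F = F} {Z = Z} ((j , Fj≡Z) , f , _ , (_ , R⁺∋ , _)) with replaceBy-cases F Z f j
  ... | inj₁ (_ , Rj≡Z) = subst (ℋ ⁺∋_) Rj≡Z (R⁺∋ j)
  ... | inj₂ (Fj≢Z , _) = ⊥-elim (Fj≢Z Fj≡Z)

  master-replacementEdge : ∀ {n F q Z} → IsMasterCopy {H} ℋ n F q Z → ∀ i → F i ≢ Z →
    ∃[ e ] (e ∈ E[ Z ] × q i ∈ᶜ e ⁺ × (∀ j → next j ≡ i → q j ∈ᶜ e ⁺))
  master-replacementEdge {F = F} {q} {Z} (_ , f , f∈Z , (_ , _ , _ , _ , joins)) i Fi≢Z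
    with replaceBy-cases F Z f i
  ... | inj₁ (Fi≡Z , _) = ⊥-elim (Fi≢Z Fi≡Z)
  ... | inj₂ (ne , Ri≡e⁺) =
    f i ne , f∈Z i ne , subst (q i ∈ᶜ_) Ri≡e⁺ (Joins⇒∈ᶜˡ (q i) (joins i)) ,
    λ { j refl → subst (q j ∈ᶜ_) Ri≡e⁺ (Joins⇒∈ᶜʳ (q j) (joins j)) }

  spanningEdge⇒master : ∀ {F q} → IsCycle {H} ℋ 2 F q → ∀ j → ¬ IsEdgeCopy {H} (F j) →
    ∀ {g} → g ∈ E[ F j ] → (∀ a → q a ∈ᶜ g ⁺) → IsMasterCopy {H} ℋ 2 F q (F j)
  spanningEdge⇒master {F} {q} cycle@(length , F⁺∋ , F≢F∘next , q-inj , _) j Fj-real {g} g∈Fj q∈g⁺ =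
    (j , refl) , (λ _ _ → g) , (λ _ _ → g∈Fj) , (length , R⁺∋ , R≢R∘next , q-inj , joins)
    where
      R : Fin 2 → SubHG H
      R = replaceBy F (F j) (λ _ _ → g)
      cases : ∀ i → (F i ≡ F j × R i ≡ F j) ⊎ ∃[ ne ] (R i ≡ g ⁺)
      cases = replaceBy-cases F (F j) (λ _ _ → g)
      R⁺∋ : ∀ i → ℋ ⁺∋ R i
      R⁺∋ i with cases i
      ... | inj₁ (_ , Ri≡Fj) = subst (ℋ ⁺∋_) (sym Ri≡Fj) (F⁺∋ j)
      ... | inj₂ (_ , Ri≡g⁺) = inj₂ (g , Ri≡g⁺)
      q∈ᶜR : ∀ a i → q a ∈ᶜ R i
      q∈ᶜR a i with cases i
      ... | inj₁ (_ , Ri≡Fj) = subst (q a ∈ᶜ_) (sym Ri≡Fj) (cycle₂-connector∈ᶜ {ℋ = ℋ} cycle a j)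
      ... | inj₂ (_ , Ri≡g⁺) = subst (q a ∈ᶜ_) (sym Ri≡g⁺) (q∈g⁺ a)
      joins : ∀ i → Joins {H} (q i) (R i) (R (next i))
      joins i = ∈ᶜ⇒Joins (q i) (q∈ᶜR i i) (q∈ᶜR i (next i))
      R≢R∘next : ∀ i → R i ≢ R (next i)
      R≢R∘next i with cases i | cases (next i)
      ... | inj₁ (Fi≡Fj , _) | inj₁ (Fnext≡Fj , _) = λ _ → F≢F∘next i (trans Fi≡Fj (sym Fnext≡Fj))
      ... | inj₁ (_ , Ri≡Fj) | inj₂ (_ , Rnext≡g⁺) =
        λ Ri≡Rnext → Fj-real (g , trans (sym Ri≡Fj) (trans Ri≡Rnext Rnext≡g⁺))
      ... | inj₂ (_ , Ri≡g⁺) | inj₁ (_ , Rnext≡Fj) =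
        λ Ri≡Rnext → Fj-real (g , trans (sym Rnext≡Fj) (trans (sym Ri≡Rnext) Ri≡g⁺))
      ... | inj₂ (Fi≢Fj , _) | inj₂ (Fnext≢Fj , _) with ≡∨≡next₂ i j
      ...   | inj₁ j≡i     = λ _ → Fi≢Fj (cong F (sym j≡i))
      ...   | inj₂ j≡nexti = λ _ → Fnext≢Fj (cong F (sym j≡nexti))

  module _ (ℋ⇒IsSubHG : ∀ F → ℋ F → IsSubHG H F) where

    ⁺∋⇒IsSubHG : ∀ {X} → ℋ ⁺∋ X → IsSubHG H X
    ⁺∋⇒IsSubHG (inj₁ X∈ℋ) = ℋ⇒IsSubHG _ X∈ℋ
    ⁺∋⇒IsSubHG (inj₂ (e , refl)) e′ e′∈⁅e⁆ =
      subst (λ f → ∀ {v} → v ∈ edge H f → v ∈ edge H e) (sym (x∈⁅y⁆⇒x≡y e e′∈⁅e⁆)) (λ v∈ → v∈)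

    connector∈ᶜmaster : ∀ {n F q Z} → IsMasterCopy {H} ℋ n F q Z → ∀ a → q a ∈ᶜ Z
    connector∈ᶜmaster {F = F} {q} {Z} master@(_ , f , f∈Z , (_ , _ , _ , _ , joins)) a
      with replaceBy-cases F Z f a
    ... | inj₁ (_ , Ra≡Z) = subst (q a ∈ᶜ_) Ra≡Z (Joins⇒∈ᶜˡ (q a) (joins a))
    ... | inj₂ (ne , Ra≡e⁺) =
      ∈ᶜ⁺⇒∈ᶜ (⁺∋⇒IsSubHG (master⇒⁺∋ master)) (f∈Z a ne) (q a)
        (subst (q a ∈ᶜ_) Ra≡e⁺ (Joins⇒∈ᶜˡ (q a) (joins a)))

    pairCycle : ∀ {X Y} → X ≢ Y → ℋ ⁺∋ X → ℋ ⁺∋ Y → (Q : Fin 2 → Conn H) →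
      (∀ a b → Q a ≡ Q b → a ≡ b) → T1 {H} Q → (∀ a → Q a ∈ᶜ X) → (∀ a → Q a ∈ᶜ Y) →
      IsTidyCycle {H} ℋ 2 (X ∷ Y ∷ []) Q
    pairCycle {X} {Y} X≢Y X⁺∋ Y⁺∋ Q Q-inj t1 Q∈X Q∈Y =
      (s≤s (s≤s z≤n) , ⁺∋ , distinct , Q-inj , joins) , t1 , λ _ → zero , λ _ _ _ _ → ≡∨≡next₂ zero _
      where
        ⁺∋ : ∀ i → ℋ ⁺∋ (X ∷ Y ∷ []) i
        ⁺∋ zero       = X⁺∋
        ⁺∋ (suc zero) = Y⁺∋
        distinct : ∀ i → (X ∷ Y ∷ []) i ≢ (X ∷ Y ∷ []) (next i)
        distinct zero       = X≢Y
        distinct (suc zero) = X≢Y ∘ sym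
        joins : ∀ i → Joins {H} (Q i) ((X ∷ Y ∷ []) i) ((X ∷ Y ∷ []) (next i))
        joins zero       = ∈ᶜ⇒Joins (Q zero) (Q∈X zero) (Q∈Y zero)
        joins (suc zero) = ∈ᶜ⇒Joins (Q (suc zero)) (Q∈Y (suc zero)) (Q∈X (suc zero))

    module _ (girth : Girth>22 H ℋ) where

      cycle₂-spanningEdge : ∀ {P Q} → IsTidyCycle {H} ℋ 2 P Q →
        ∃[ j ] ∃[ g ] (g ∈ E[ P j ] × g ⁺ ≢ P j × (∀ a → Q a ∈ᶜ g ⁺))
      cycle₂-spanningEdge {P} {Q} tidy@((_ , _ , P≢P∘next , _ , _) , _) with girth 2 P Q tidy (h≤22-length2 Q)
      ... | _ , (j , refl) , f , f∈Pj , R-cycle@(_ , _ , R≢R∘next , _ , _)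
        with replaceBy-cases P (P j) f j | replaceBy-cases P (P j) f (next j)
      ... | inj₂ (Pj≢Pj , _) | _ = ⊥-elim (Pj≢Pj refl)
      ... | _ | inj₁ (Pnext≡Pj , _) = ⊥-elim (P≢P∘next j (sym Pnext≡Pj))
      ... | inj₁ (_ , Rj≡Pj) | inj₂ (ne , Rnext≡g⁺) =
        j , f (next j) ne , f∈Pj (next j) ne ,
        (λ g⁺≡Pj → R≢R∘next j (trans Rj≡Pj (trans (sym g⁺≡Pj) (sym Rnext≡g⁺)))) ,
        λ a → subst (Q a ∈ᶜ_) Rnext≡g⁺ (cycle₂-connector∈ᶜ {ℋ = ℋ} R-cycle a (next j))

      -- The master of the cycle F j, g₀ ⁺ is not g₀ ⁺, since the edge copy of its only edge is g₀ ⁺ itself.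
      realCopy-spanningEdge : ∀ {F q} → IsTidyCycle {H} ℋ 2 F q → ∀ j → ¬ IsEdgeCopy {H} (F j) →
        ∃[ g ] (g ∈ E[ F j ] × (∀ a → q a ∈ᶜ g ⁺))
      realCopy-spanningEdge {F} {q} tidy@(cycle@(_ , F⁺∋ , _ , q-inj , _) , t1 , _) j Fj-real
        with cycle₂-spanningEdge tidy
      ... | _ , g₀ , _ , _ , q∈g₀⁺
        with cycle₂-spanningEdge (pairCycle (λ Fj≡g₀⁺ → Fj-real (g₀ , Fj≡g₀⁺)) (F⁺∋ j) (inj₂ (g₀ , refl))
               q q-inj t1 (λ a → cycle₂-connector∈ᶜ {ℋ = ℋ} cycle a j) q∈g₀⁺)
      ... | zero , g , g∈Fj , _ , q∈g⁺ = g , g∈Fj , q∈g⁺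
      ... | suc zero , g , g∈⁅g₀⁆ , g⁺≢g₀⁺ , _ = ⊥-elim (g⁺≢g₀⁺ (cong _⁺ (x∈⁅y⁆⇒x≡y g₀ g∈⁅g₀⁆)))

      length2-realCopy-master : ∀ {F q} → IsTidyCycle {H} ℋ 2 F q →
        ∀ j → ¬ IsEdgeCopy {H} (F j) → IsMasterCopy {H} ℋ 2 F q (F j)
      length2-realCopy-master tidy j Fj-real =
        let g , g∈Fj , q∈g⁺ = realCopy-spanningEdge tidy j Fj-real
        in spanningEdge⇒master (proj₁ tidy) j Fj-real g∈Fj q∈g⁺

      module DistinctMasters {n} {F : Fin n → SubHG H} {q : Fin n → Conn H}
        (tidy : IsTidyCycle {H} ℋ n F q) {A B : SubHG H}
        (A-master : IsMasterCopy {H} ℋ n F q A) (B-master : IsMasterCopy {H} ℋ n F q B)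
        (A≢B : A ≢ B) where

        q-inj : ∀ i j → q i ≡ q j → i ≡ j
        q-inj = proj₁ (proj₂ (proj₂ (proj₂ (proj₁ tidy))))

        t1 : T1 {H} q
        t1 = proj₁ (proj₂ tidy)

        masters-spanningEdge : (Q : Fin 2 → Conn H) → (∀ a b → Q a ≡ Q b → a ≡ b) → T1 {H} Q →
          (∀ a → Q a ∈ᶜ A) → (∀ a → Q a ∈ᶜ B) → ∃[ g ] (∀ a → Q a ∈ᶜ g ⁺)
        masters-spanningEdge Q Q-inj Q-t1 Q∈A Q∈B =
          let _ , g , _ , _ , Q∈g⁺ = cycle₂-spanningEdge
                (pairCycle A≢B (master⇒⁺∋ A-master) (master⇒⁺∋ B-master) Q Q-inj Q-t1 Q∈A Q∈B)
          in g , Q∈g⁺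

        connectorPair-vertices : ∀ {a b} → a ≢ b →
          ∃[ g ] ∃[ u ] ∃[ v ] (q a ≡ inj₁ u × q b ≡ inj₁ v × u ∈ edge H g × v ∈ edge H g)
        connectorPair-vertices {a} {b} a≢b =
          let g , Q∈g⁺ = masters-spanningEdge (q ∘ σ) σ-inj (λ i j → t1 (σ i) (σ j))
                           (connector∈ᶜmaster A-master ∘ σ) (connector∈ᶜmaster B-master ∘ σ)
          in g , connectors-in-edge⇒vertices q-inj t1 a≢b (Q∈g⁺ zero) (Q∈g⁺ (suc zero))
          where
            σ : Fin 2 → Fin n
            σ = a ∷ b ∷ []
            σ-inj : ∀ i j → q (σ i) ≡ q (σ j) → i ≡ j
            σ-inj zero       zero       _     = refl
            σ-inj zero       (suc zero) qa≡qb = ⊥-elim (a≢b (q-inj a b qa≡qb))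
            σ-inj (suc zero) zero       qb≡qa = ⊥-elim (a≢b (q-inj a b (sym qb≡qa)))
            σ-inj (suc zero) (suc zero) _     = refl

        connector-isVertex : ∀ {a b} → a ≢ b → ∃[ w ] (q a ≡ inj₁ w)
        connector-isVertex a≢b =
          let _ , u , _ , qa≡u , _ = connectorPair-vertices a≢b in u , qa≡u

        -- Otherwise the edge e and the vertex w would be the connectors of a tidy
        -- length-2 cycle on A and B, whose spanning edge must be e itself.
        vertexConnector∈sharedEdge : ∀ {e a w} → e ∈ E[ A ] → e ∈ E[ B ] →
          q a ≡ inj₁ w → w ∈ edge H e
        vertexConnector∈sharedEdge {e} {a} {w} e∈A e∈B qa≡w =
          decidable-stable (w ∈? edge H e) λ w∉e →
            let g , Q∈g⁺ = masters-spanningEdge Q Q-inj (Q-t1 w∉e) (Q∈ e∈A A-master) (Q∈ e∈B B-master)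
            in w∉e (subst (λ f → w ∈ edge H f) (sym (x∈⁅y⁆⇒x≡y g (Q∈g⁺ zero))) (Q∈g⁺ (suc zero)))
          where
            Q : Fin 2 → Conn H
            Q = inj₂ e ∷ inj₁ w ∷ []
            Q-inj : ∀ i j → Q i ≡ Q j → i ≡ j
            Q-inj zero       zero       _  = refl
            Q-inj zero       (suc zero) ()
            Q-inj (suc zero) zero       ()
            Q-inj (suc zero) (suc zero) _  = refl
            Q-t1 : ¬ w ∈ edge H e → T1 {H} Q
            Q-t1 w∉e (suc zero) zero       _ _ refl refl = w∉e
            Q-t1 _   zero       _          _ _ ()   _
            Q-t1 _   (suc zero) (suc zero) _ _ _    ()
            Q∈ : ∀ {Z} → e ∈ E[ Z ] → IsMasterCopy {H} ℋ n F q Z → ∀ i → Q i ∈ᶜ Z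
            Q∈ e∈Z _        zero       = e∈Z
            Q∈ _   Z-master (suc zero) = subst (_∈ᶜ _) qa≡w (connector∈ᶜmaster Z-master a)

      distinctMasters-length≥4 : ∀ {m F q} → IsTidyCycle {H} ℋ (4 + m) F q → ∀ {A B} →
        IsMasterCopy {H} ℋ (4 + m) F q A → IsMasterCopy {H} ℋ (4 + m) F q B → A ≢ B → ⊥
      distinctMasters-length≥4 tidy A-master B-master A≢B =
        let g , u , v , q0≡u , q2≡v , u∈g , v∈g = connectorPair-vertices {zero} {suc (suc zero)} (λ ())
            s , steps = proj₂ (proj₂ tidy) g
        in ¬zero-two-in-step s (steps zero u q0≡u u∈g) (steps _ v q2≡v v∈g)
        where open DistinctMasters tidy A-master B-master A≢B

      distinctMasters-length3 : Linear H → ∀ {F q} → IsTidyCycle {H} ℋ 3 F q → ∀ {A B} →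
        IsMasterCopy {H} ℋ 3 F q A → IsMasterCopy {H} ℋ 3 F q B → A ≢ B → ⊥
      distinctMasters-length3 lin {F} tidy@((_ , _ , F≢F∘next , _ , _) , _ , t2) {A} {B} A-master B-master A≢B =
        let i , Fi≢A , Fi≢B = ∃-avoiding-pair₃ _≟S_ F F≢F∘next A B
            e , e∈A , qi∈e , qprev∈e = master-replacementEdge A-master i Fi≢A
            e′ , e′∈B , qi∈e′ , qprev∈e′ = master-replacementEdge B-master i Fi≢B
            e≡e′ = connectorPair-determinesEdge lin q-inj t1 (≢next²₃ i)
                     qi∈e (qprev∈e _ (next³≡id i)) qi∈e′ (qprev∈e′ _ (next³≡id i))
            e∈B = subst (_∈ E[ B ]) (sym e≡e′) e′∈B
            s , steps = t2 e
            inStep : ∀ a → a ≡ s ⊎ a ≡ next s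
            inStep a = let w , qa≡w = connector-isVertex (≢next₃ a)
                       in steps a w qa≡w (vertexConnector∈sharedEdge e∈A e∈B qa≡w)
        in ¬three-distinct-in-pair (≢next₃ i) (≢next₃ (next i)) (≢next²₃ i ∘ sym)
             (inStep i) (inStep (next i)) (inStep (next (next i)))
        where open DistinctMasters tidy A-master B-master A≢B

      distinctMasters⇒⊥ : Linear H → ∀ {n F q} → 3 ≤ n → IsTidyCycle {H} ℋ n F q → ∀ {A B} →
        IsMasterCopy {H} ℋ n F q A → IsMasterCopy {H} ℋ n F q B → A ≢ B → ⊥
      distinctMasters⇒⊥ lin {3}                     (s≤s (s≤s (s≤s z≤n))) = distinctMasters-length3 lin
      distinctMasters⇒⊥ _   {suc (suc (suc (suc _)))} (s≤s (s≤s (s≤s z≤n))) = distinctMasters-length≥4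

lemma4p14 : (H : Hypergraph) → Linear H →
    (ℋ : Pred (SubHG H) 0ℓ) → (∀ F → ℋ F → IsSubHG H F) →
    Girth>22 H ℋ →
    (n : ℕ) (F : Fin n → SubHG H) (q : Fin n → Conn H) →
    IsTidyCycle {H} ℋ n F q →
    ((n ≡ 2 → ∀ j → ¬ IsEdgeCopy {H} (F j) → IsMasterCopy {H} ℋ n F q (F j)) ×
     (3 ≤ n → ∀ F⋆ F⋆′ → IsMasterCopy {H} ℋ n F q F⋆ → IsMasterCopy {H} ℋ n F q F⋆′ → F⋆ ≡ F⋆′))
lemma4p14 H lin ℋ ℋ⇒IsSubHG girth n F q tidy = length2 tidy , length≥3 tidy
  where
    length2 : ∀ {n F q} → IsTidyCycle {H} ℋ n F q → n ≡ 2 →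
      ∀ j → ¬ IsEdgeCopy {H} (F j) → IsMasterCopy {H} ℋ n F q (F j)
    length2 tidy refl = length2-realCopy-master ℋ⇒IsSubHG girth tidy
    length≥3 : ∀ {n F q} → IsTidyCycle {H} ℋ n F q → 3 ≤ n →
      ∀ F⋆ F⋆′ → IsMasterCopy {H} ℋ n F q F⋆ → IsMasterCopy {H} ℋ n F q F⋆′ → F⋆ ≡ F⋆′
    length≥3 tidy 3≤n F⋆ F⋆′ F⋆-master F⋆′-master =
      decidable-stable (F⋆ ≟S F⋆′) (distinctMasters⇒⊥ ℋ⇒IsSubHG girth lin 3≤n tidy F⋆-master F⋆′-master)
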